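{- Let $F(x)=\frac{x}{1+x}$. For every reduced fraction $x\in[0,1]$ and every $k\ge5$, $$P\big(k+1,F(x)\big)=\frac{1}{1+x}\,P(k,x).$$
   Context: Farey binary tree: $\ell_1=\{0/1,1/1\}$, $\ell_{n+1}$ = mediants $\frac{p+p'}{q+q'}$ of pairs $p/q<p'/q'$ adjacent in $\bigcup_{i\le n}\ell_i$; each reduced $p/q\in(0,1)$ is the mediant of a unique adjacent pair $p_1/q_1<p_2/q_2$ (its parents). Haros graphs: $G_0$ has two nodes joined by an edge. For ordered-node graphs $G$ ($v_1,\dots,v_a$) and $G'$ ($w_1,\dots,w_b$), $G\oplus G'$ has nodes $u_1,\dots,u_{a+b-1}$ obtained by identifying $v_a$ with $w_1$, keeping all edges, and adding an edge $u_1u_{a+b-1}$. $G_{0/1}=G_{1/1}=G_0$, $G_{p/q}=G_{p_1/q_1}\oplus G_{p_2/q_2}$ ($q+1$ nodes). Degree convention: the first and last nodes are identified into one boundary node whose degree is the sum of their degrees, giving $q$ nodes; $P(k,p/q)$ is the fraction of these $q$ nodes having degree $k$. -}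

module Defs where

open import Data.Nat as ℕ using (ℕ; zero; suc; _+_; _*_; _∸_; _≡ᵇ_; _<ᵇ_)
open import Data.Bool using (Bool; true; false; if_then_else_; _∧_; _∨_)
open import Data.Product using (_×_; _,_)
open import Data.List using (List; []; _∷_; map; _++_; length; filter; upTo)
open import Data.Integer using (ℤ; +_; ∣_∣)
open import Data.Rational as ℚ using (ℚ; ↥_; ↧ₙ_; 0ℚ; 1ℚ; _/_; _≤_; 1/_)
open import Data.Rational.Properties using (pos⇒nonZero; pos+nonNeg⇒pos)

-- Graphs with ordered nodes: a graph with `size` nodes u_0,…,u_{size-1}
-- (0-indexed here; node u_i of the paper is index i-1) and a list of
-- edges, each edge an (unordered) pair of node indices.

record Graph : Set where
  constructor graph
  field
    size  : ℕ
    edges : List (ℕ × ℕ)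
open Graph public

G₀ : Graph
G₀ = graph 2 ((0 , 1) ∷ [])

-- G ⊕ G' : identify the last node of G (index a-1) with the first node of
-- G' (index 0), so node j of G' becomes node (a-1)+j; keep all edges and
-- add an edge between the first node (0) and the last node (a+b-2).
_⊕_ : Graph → Graph → Graph
graph a E ⊕ graph b E' =
  graph (a + b ∸ 1)
        ((0 , a + b ∸ 2) ∷ E ++ map (λ { (i , j) → (a ∸ 1 + i , a ∸ 1 + j) }) E')

-- Descending the Farey (Stern–Brocot) tree: starting from the adjacent pair
-- 0/1 < 1/1, the mediant of the current adjacent pair l < r is m; if the
-- target p/q equals m then (l , r) are its parents, otherwise we descend into
-- (l , m) or (m , r).  Along the way we carry the Haros graphs of l and r,
-- so that G_{p/q} = G_{p₁/q₁} ⊕ G_{p₂/q₂} for the parents p₁/q₁ < p₂/q₂.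
-- The fuel (q suffices, since the depth of p/q in the tree is < q) only
-- serves to make the recursion structural.

harosDescend : (fuel : ℕ) →
               (p₁ q₁ : ℕ) → Graph → (p₂ q₂ : ℕ) → Graph →
               (p q : ℕ) → Graph
harosDescend zero    p₁ q₁ G₁ p₂ q₂ G₂ p q = G₀
harosDescend (suc f) p₁ q₁ G₁ p₂ q₂ G₂ p q =
  let pm = p₁ + p₂ ; qm = q₁ + q₂ ; Gm = G₁ ⊕ G₂ in
  if (p * qm ≡ᵇ pm * q) then Gm
  else if (p * qm <ᵇ pm * q)
       then harosDescend f p₁ q₁ G₁ pm qm Gm p q
       else harosDescend f pm qm Gm p₂ q₂ G₂ p q

haros : (p q : ℕ) → Graph
haros p q =
  if (p ≡ᵇ 0) then G₀
  else if (p ≡ᵇ q) then G₀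
  else harosDescend q 0 1 G₀ 1 1 G₀ p q

deg : Graph → ℕ → ℕ
deg G i = go (edges G)
  where
  hit : ℕ → ℕ
  hit j = if (i ≡ᵇ j) then 1 else 0
  go : List (ℕ × ℕ) → ℕ
  go []            = 0
  go ((a , b) ∷ E) = hit a + hit b + go E

-- Number of nodes of degree k in G_{p/q} with the boundary convention:
-- the first node (index 0) and last node (index q) are identified into one
-- boundary node of degree deg 0 + deg q; the other nodes are 1,…,q-1.
-- Altogether q nodes.
countDeg : ℕ → (p q : ℕ) → ℕ
countDeg k p q =
  (if (deg G 0 + deg G q ≡ᵇ k) then 1 else 0)
  + length (filter (λ i → (deg G (suc i)) ℕ.≟ k) (upTo (q ∸ 1)))
  where G = haros p q

P : ℕ → ℚ → ℚ
P k x = (+ countDeg k ∣ ↥ x ∣ (↧ₙ x)) / (↧ₙ x)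

-- F(x) = x / (1 + x), for x ≥ 0 (so that 1 + x ≠ 0).

1/[1+_] : (x : ℚ) → 0ℚ ≤ x → ℚ
1/[1+ x ] h = (1/ (1ℚ ℚ.+ x)) {{pos⇒nonZero (1ℚ ℚ.+ x) {{pos+nonNeg⇒pos 1ℚ x {{ℚ.nonNegative h}}}}}}

F : (x : ℚ) → 0ℚ ≤ x → ℚ
F x h = x ℚ.* 1/[1+ x ] h

-- F(p/q) = p/(p+q) maps the Farey tree below 0/1, 1/1 onto the part below 0/1, 1/2 and commutes
-- with mediants, so G_{F(x)} is built by the same ⊕-steps as G_x, only starting from G_{1/2} = G₀ ⊕ G₀
-- instead of G_{1/1} = G₀.  Running both descents side by side, the first node keeps its degree while
-- the last node and every node where two inner pieces are glued gain one edge; the remaining nodes,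
-- including those next to the pieces G_{0/1}, G_{1/1}, G_{1/2}, have degree at most 5 in both graphs.
-- Hence for k ≥ 5, G_{F(p/q)} has as many nodes of degree k + 1 as G_{p/q} has of degree k, and
-- dividing by p + q = q (1 + x) instead of q gives the factor 1/(1 + x).

module Submission where

open import Defs
open import Data.Nat using (ℕ; suc; _+_)
import Data.Nat
open import Relation.Binary.PropositionalEquality

module HarosDegrees where

  open import Data.Bool using (true; false; if_then_else_)
  open import Data.Bool.Properties using (T-≡; ¬-not)
  open import Data.List using (List; []; _∷_; map; _++_; length; filter; applyUpTo)
  open import Data.Nat using (zero; _*_; _∸_; _≡ᵇ_; _<ᵇ_; _<_; _≤_; _≟_; z≤n; s≤s; z<s; NonZero; >-nonZero)
  open import Data.Nat.Coprimality using (Coprime; coprime-divisor; 0-coprimeTo-m⇒m≡1)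
  import Data.Nat.Coprimality as Coprime
  open import Data.Nat.Divisibility using (_∣_; divides; ∣⇒≤; ∣-refl)
  open import Data.Nat.Properties
  open import Algebra.Properties.CommutativeSemigroup +-commutativeSemigroup using (interchange)
  open import Data.Nat.Tactic.RingSolver using (solve-∀)
  open import Data.Product using (_×_; _,_; proj₁; proj₂)
  open import Data.Sum using (inj₁; inj₂)
  open import Function using (_∘_)
  open import Function.Bundles using (Equivalence)
  open import Relation.Binary.Definitions using (tri<; tri≈; tri>)
  open import Relation.Nullary using (contradiction)

  δ : ℕ → ℕ → ℕ
  δ m n = if m ≡ᵇ n then 1 else 0

  ≢⇒≡ᵇ≡false : ∀ {m n} → m ≢ n → (m ≡ᵇ n) ≡ false
  ≢⇒≡ᵇ≡false {m} {n} m≢n = ¬-not (m≢n ∘ ≡ᵇ⇒≡ m n ∘ Equivalence.from T-≡)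

  ≡⇒≡ᵇ≡true : ∀ {m n} → m ≡ n → (m ≡ᵇ n) ≡ true
  ≡⇒≡ᵇ≡true {m} {n} = Equivalence.to T-≡ ∘ ≡⇒≡ᵇ m n

  <⇒<ᵇ≡true : ∀ {m n} → m < n → (m <ᵇ n) ≡ true
  <⇒<ᵇ≡true = Equivalence.to T-≡ ∘ <⇒<ᵇ

  ≥⇒<ᵇ≡false : ∀ {m n} → n ≤ m → (m <ᵇ n) ≡ false
  ≥⇒<ᵇ≡false {m} {n} n≤m = ¬-not λ m<ᵇn → <⇒≱ (<ᵇ⇒< m n (Equivalence.from T-≡ m<ᵇn)) n≤m

  δ-refl : ∀ n → δ n n ≡ 1
  δ-refl n rewrite ≡⇒≡ᵇ≡true (refl {x = n}) = refl

  δ-≢ : ∀ {m n} → m ≢ n → δ m n ≡ 0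
  δ-≢ m≢n rewrite ≢⇒≡ᵇ≡false m≢n = refl

  degreeIn : ℕ → List (ℕ × ℕ) → ℕ
  degreeIn i []            = 0
  degreeIn i ((a , b) ∷ E) = δ i a + δ i b + degreeIn i E

  deg-graph : ∀ n E i → deg (graph n E) i ≡ degreeIn i E
  deg-graph n []            i = refl
  deg-graph n ((a , b) ∷ E) i = cong (δ i a + δ i b +_) (deg-graph n E i)

  degreeIn-++ : ∀ i E E′ → degreeIn i (E ++ E′) ≡ degreeIn i E + degreeIn i E′
  degreeIn-++ i []            E′ = refl
  degreeIn-++ i ((a , b) ∷ E) E′ =
    trans (cong (δ i a + δ i b +_) (degreeIn-++ i E E′)) (sym (+-assoc (δ i a + δ i b) _ _))

  -- Projections rather than a pair pattern, so that this agrees definitionally with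
  -- the relabelling used in `_⊕_`.
  shift : ℕ → ℕ × ℕ → ℕ × ℕ
  shift s e = (s + proj₁ e , s + proj₂ e)

  δ-+ˡ : ∀ s i j → δ (s + i) (s + j) ≡ δ i j
  δ-+ˡ zero    i j = refl
  δ-+ˡ (suc s) i j = δ-+ˡ s i j

  degreeIn-shift : ∀ s i E → degreeIn (s + i) (map (shift s) E) ≡ degreeIn i E
  degreeIn-shift s i []            = refl
  degreeIn-shift s i ((a , b) ∷ E) =
    cong₂ _+_ (cong₂ _+_ (δ-+ˡ s i a) (δ-+ˡ s i b)) (degreeIn-shift s i E)

  δ-<-+ : ∀ {i} s a → i < s → δ i (s + a) ≡ 0
  δ-<-+ s a i<s = δ-≢ λ eq → <⇒≱ i<s (subst (s ≤_) (sym eq) (m≤m+n s a))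

  degreeIn-shift-< : ∀ s {i} E → i < s → degreeIn i (map (shift s) E) ≡ 0
  degreeIn-shift-< s []            i<s = refl
  degreeIn-shift-< s ((a , b) ∷ E) i<s
    rewrite δ-<-+ s a i<s | δ-<-+ s b i<s = degreeIn-shift-< s E i<s

  count : ℕ → (ℕ → ℕ) → ℕ → ℕ
  count k f zero    = 0
  count k f (suc n) = δ (f 0) k + count k (f ∘ suc) n

  length-filter-applyUpTo : ∀ k (g f : ℕ → ℕ) n →
    length (filter (λ i → g i ≟ k) (applyUpTo f n)) ≡ count k (g ∘ f) n
  length-filter-applyUpTo k g f zero = refl
  length-filter-applyUpTo k g f (suc n) with g (f 0) ≡ᵇ k
  ... | true  = cong suc (length-filter-applyUpTo k g (f ∘ suc) n)
  ... | false = length-filter-applyUpTo k g (f ∘ suc) n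

  count-+ : ∀ k f m n → count k f (m + n) ≡ count k f m + count k (λ i → f (m + i)) n
  count-+ k f zero    n = refl
  count-+ k f (suc m) n =
    trans (cong (δ (f 0) k +_) (count-+ k (f ∘ suc) m n)) (sym (+-assoc (δ (f 0) k) _ _))

  count-cong : ∀ k {f g} n → (∀ i → i < n → f i ≡ g i) → count k f n ≡ count k g n
  count-cong k zero    f≗g = refl
  count-cong k (suc n) f≗g =
    cong₂ _+_ (cong (λ d → δ d k) (f≗g 0 (s≤s z≤n))) (count-cong k n (λ i i<n → f≗g (suc i) (s≤s i<n)))

  boundaryDeg : Graph → ℕ → ℕ
  boundaryDeg G q = deg G 0 + deg G q

  interiorCount : ℕ → Graph → ℕ → ℕ
  interiorCount k G q = count k (λ i → deg G (suc i)) (q ∸ 1)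

  countDeg-split : ∀ k p q →
    countDeg k p q ≡ δ (boundaryDeg (haros p q) q) k + interiorCount k (haros p q) q
  countDeg-split k p q = cong (δ (boundaryDeg (haros p q) q) k +_)
    (length-filter-applyUpTo k (λ i → deg (haros p q) (suc i)) (λ i → i) (q ∸ 1))

  -- Degrees in a glued graph

  data Spans (G : Graph) : ℕ → Set where
    spans : ∀ {q} → size G ≡ suc (suc q) → (∀ i → suc q < i → deg G i ≡ 0) → Spans G (suc q)

  spans⇒0< : ∀ {G q} → Spans G q → 0 < q
  spans⇒0< (spans _ _) = z<s

  -- In G₁ ⊕ G₂, node i ≤ q₁ is node i of G₁ and node q₁ + j is node j of G₂.
  module Concatenation (a b : ℕ) (E₁ E₂ : List (ℕ × ℕ))
    (out₁ : ∀ i → suc a < i → deg (graph (suc (suc a)) E₁) i ≡ 0)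
    (out₂ : ∀ i → suc b < i → deg (graph (suc (suc b)) E₂) i ≡ 0) where

    q₁ q₂ : ℕ
    q₁ = suc a
    q₂ = suc b

    G₁ G₂ : Graph
    G₁ = graph (suc q₁) E₁
    G₂ = graph (suc q₂) E₂

    deg-⊕ : ∀ i → deg (G₁ ⊕ G₂) i ≡
            δ i 0 + δ i (q₁ + q₂) + (degreeIn i E₁ + degreeIn i (map (shift q₁) E₂))
    deg-⊕ i = begin
      deg (G₁ ⊕ G₂) i
        ≡⟨ deg-graph (size (G₁ ⊕ G₂)) ((0 , a + suc q₂) ∷ E₁ ++ map (shift q₁) E₂) i ⟩
      δ i 0 + δ i (a + suc q₂) + degreeIn i (E₁ ++ map (shift q₁) E₂)
        ≡⟨ cong₂ (λ l d → δ i 0 + δ i l + d) (+-suc a q₂) (degreeIn-++ i E₁ _) ⟩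
      δ i 0 + δ i (q₁ + q₂) + (degreeIn i E₁ + degreeIn i (map (shift q₁) E₂)) ∎
      where open ≡-Reasoning

    deg-⊕-left : ∀ i → i < q₁ → deg (G₁ ⊕ G₂) i ≡ δ i 0 + deg G₁ i
    deg-⊕-left i i<q₁ = begin
      deg (G₁ ⊕ G₂) i
        ≡⟨ deg-⊕ i ⟩
      δ i 0 + δ i (q₁ + q₂) + (degreeIn i E₁ + degreeIn i (map (shift q₁) E₂))
        ≡⟨ cong₂ (λ x y → δ i 0 + x + (degreeIn i E₁ + y))
             (δ-<-+ q₁ q₂ i<q₁) (degreeIn-shift-< q₁ E₂ i<q₁) ⟩
      δ i 0 + 0 + (degreeIn i E₁ + 0)
        ≡⟨ cong₂ _+_ (+-identityʳ (δ i 0)) (trans (+-identityʳ _) (sym (deg-graph (suc q₁) E₁ i))) ⟩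
      δ i 0 + deg G₁ i ∎
      where open ≡-Reasoning

    deg-⊕-right : ∀ j → 0 < j → deg (G₁ ⊕ G₂) (q₁ + j) ≡ δ j q₂ + deg G₂ j
    deg-⊕-right j 0<j = begin
      deg (G₁ ⊕ G₂) (q₁ + j)
        ≡⟨ deg-⊕ (q₁ + j) ⟩
      δ (q₁ + j) (q₁ + q₂) + (degreeIn (q₁ + j) E₁ + degreeIn (q₁ + j) (map (shift q₁) E₂))
        ≡⟨ cong₂ (λ x y → x + (y + degreeIn (q₁ + j) (map (shift q₁) E₂)))
             (δ-+ˡ q₁ j q₂) (trans (sym (deg-graph (suc q₁) E₁ (q₁ + j))) (out₁ (q₁ + j) (m<m+n q₁ 0<j))) ⟩
      δ j q₂ + degreeIn (q₁ + j) (map (shift q₁) E₂)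
        ≡⟨ cong (δ j q₂ +_) (trans (degreeIn-shift q₁ j E₂) (sym (deg-graph (suc q₂) E₂ j))) ⟩
      δ j q₂ + deg G₂ j ∎
      where open ≡-Reasoning

    deg-⊕-junction : deg (G₁ ⊕ G₂) q₁ ≡ deg G₁ q₁ + deg G₂ 0
    deg-⊕-junction = begin
      deg (G₁ ⊕ G₂) q₁
        ≡⟨ deg-⊕ q₁ ⟩
      δ q₁ (q₁ + q₂) + (degreeIn q₁ E₁ + degreeIn q₁ (map (shift q₁) E₂))
        ≡⟨ cong₂ (λ x y → x + (degreeIn q₁ E₁ + y))
             (trans (cong (λ i → δ i (q₁ + q₂)) (sym (+-identityʳ q₁))) (δ-+ˡ q₁ 0 q₂))
             (trans (cong (λ i → degreeIn i (map (shift q₁) E₂)) (sym (+-identityʳ q₁)))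
                    (degreeIn-shift q₁ 0 E₂)) ⟩
      degreeIn q₁ E₁ + degreeIn 0 E₂
        ≡⟨ sym (cong₂ _+_ (deg-graph (suc q₁) E₁ q₁) (deg-graph (suc q₂) E₂ 0)) ⟩
      deg G₁ q₁ + deg G₂ 0 ∎
      where open ≡-Reasoning

    spans-⊕ : Spans (G₁ ⊕ G₂) (q₁ + q₂)
    spans-⊕ = spans (cong suc (+-suc a q₂)) out
      where
      out : ∀ i → q₁ + q₂ < i → deg (G₁ ⊕ G₂) i ≡ 0
      out i q<i = begin
        deg (G₁ ⊕ G₂) i           ≡⟨ cong (deg (G₁ ⊕ G₂)) (sym i≡) ⟩
        deg (G₁ ⊕ G₂) (q₁ + j)    ≡⟨ deg-⊕-right j (<-≤-trans z<s q₂<j) ⟩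
        δ j q₂ + deg G₂ j         ≡⟨ cong₂ _+_ (δ-≢ (λ j≡q₂ → <-irrefl (sym j≡q₂) q₂<j)) (out₂ j q₂<j) ⟩
        0 ∎
        where
        open ≡-Reasoning
        j : ℕ
        j = i ∸ q₁
        i≡ : q₁ + j ≡ i
        i≡ = m+[n∸m]≡n (<⇒≤ (<-trans (m<m+n q₁ z<s) q<i))
        q₂<j : q₂ < j
        q₂<j = +-cancelˡ-< q₁ q₂ j (subst (q₁ + q₂ <_) (sym i≡) q<i)

    interiorCount-⊕ : ∀ k → interiorCount k (G₁ ⊕ G₂) (q₁ + q₂) ≡
                      interiorCount k G₁ q₁ + (δ (deg G₁ q₁ + deg G₂ 0) k + interiorCount k G₂ q₂)
    interiorCount-⊕ k = begin
      count k h (a + q₂)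
        ≡⟨ count-+ k h a q₂ ⟩
      count k h a + (δ (h (a + 0)) k + count k (λ i → h (a + suc i)) b)
        ≡⟨ cong₂ _+_ (count-cong k a left)
             (cong₂ _+_ (cong (λ d → δ d k) junction) (count-cong k b right)) ⟩
      interiorCount k G₁ q₁ + (δ (deg G₁ q₁ + deg G₂ 0) k + interiorCount k G₂ q₂) ∎
      where
      open ≡-Reasoning
      h : ℕ → ℕ
      h i = deg (G₁ ⊕ G₂) (suc i)
      left : ∀ i → i < a → h i ≡ deg G₁ (suc i)
      left i i<a = deg-⊕-left (suc i) (s≤s i<a)
      junction : h (a + 0) ≡ deg G₁ q₁ + deg G₂ 0
      junction = trans (cong (λ i → h i) (+-identityʳ a)) deg-⊕-junction
      right : ∀ i → i < b → h (a + suc i) ≡ deg G₂ (suc i)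
      right i i<b = trans (deg-⊕-right (suc i) z<s) (cong (_+ deg G₂ (suc i)) (δ-≢ (<⇒≢ (s≤s i<b))))

  spans-⊕ : ∀ {G₁ G₂ q₁ q₂} → Spans G₁ q₁ → Spans G₂ q₂ → Spans (G₁ ⊕ G₂) (q₁ + q₂)
  spans-⊕ {graph _ E₁} {graph _ E₂} (spans refl out₁) (spans refl out₂) =
    Concatenation.spans-⊕ _ _ E₁ E₂ out₁ out₂

  deg-⊕-first : ∀ {G₁ G₂ q₁ q₂} → Spans G₁ q₁ → Spans G₂ q₂ → deg (G₁ ⊕ G₂) 0 ≡ suc (deg G₁ 0)
  deg-⊕-first {graph _ E₁} {graph _ E₂} (spans refl out₁) (spans refl out₂) =
    Concatenation.deg-⊕-left _ _ E₁ E₂ out₁ out₂ 0 z<s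

  deg-⊕-last : ∀ {G₁ G₂ q₁ q₂} → Spans G₁ q₁ → Spans G₂ q₂ →
               deg (G₁ ⊕ G₂) (q₁ + q₂) ≡ suc (deg G₂ q₂)
  deg-⊕-last {graph _ E₁} {G₂@(graph _ E₂)} {q₂ = q₂} (spans refl out₁) (spans refl out₂) =
    trans (Concatenation.deg-⊕-right _ _ E₁ E₂ out₁ out₂ q₂ z<s) (cong (_+ deg G₂ q₂) (δ-refl q₂))

  interiorCount-⊕ : ∀ {G₁ G₂ q₁ q₂} → Spans G₁ q₁ → Spans G₂ q₂ → ∀ k →
    interiorCount k (G₁ ⊕ G₂) (q₁ + q₂) ≡
    interiorCount k G₁ q₁ + (δ (deg G₁ q₁ + deg G₂ 0) k + interiorCount k G₂ q₂)
  interiorCount-⊕ {graph _ E₁} {graph _ E₂} (spans refl out₁) (spans refl out₂) =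
    Concatenation.interiorCount-⊕ _ _ E₁ E₂ out₁ out₂

  -- Farey pairs around p/q

  record Bracket (p₁ q₁ p₂ q₂ p q : ℕ) : Set where
    field
      adjacent : p₂ * q₁ ≡ p₁ * q₂ + 1
      lower    : p₁ * q < p * q₁
      upper    : p * q₂ < p₂ * q
  open Bracket

  -- q = q₂ (p q₁ - p₁ q) + q₁ (p₂ q - p q₂), and both brackets are positive.
  Bracket⇒mediant-denominator-≤ : ∀ {p₁ q₁ p₂ q₂ p q} → Bracket p₁ q₁ p₂ q₂ p q → q₁ + q₂ ≤ q
  Bracket⇒mediant-denominator-≤ {p₁} {q₁} {p₂} {q₂} {p} {q} b
    with a , lower≡ ← m≤n⇒∃[o]m+o≡n (lower b) | c , upper≡ ← m≤n⇒∃[o]m+o≡n (upper b) = begin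
    q₁ + q₂                   ≤⟨ +-mono-≤ (m≤m*n q₁ (suc c)) (m≤m*n q₂ (suc a)) ⟩
    q₁ * suc c + q₂ * suc a   ≡⟨ +-cancelˡ-≡ X _ _ (sym X+q≡) ⟩
    q                         ∎
    where
    open ≤-Reasoning
    X : ℕ
    X = p * q₁ * q₂ + p₁ * q * q₂
    X+q≡ : X + q ≡ X + (q₁ * suc c + q₂ * suc a)
    X+q≡ = begin-equality
      X + q
        ≡⟨ expand-q p q p₁ q₁ q₂ ⟩
      q₂ * (p * q₁) + q * (p₁ * q₂ + 1)
        ≡⟨ cong (λ d → q₂ * (p * q₁) + q * d) (sym (adjacent b)) ⟩
      q₂ * (p * q₁) + q * (p₂ * q₁)
        ≡⟨ swap p q p₂ q₁ q₂ ⟩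
      q₂ * (p * q₁) + q₁ * (p₂ * q)
        ≡⟨ cong₂ (λ x y → q₂ * x + q₁ * y) (sym lower≡) (sym upper≡) ⟩
      q₂ * (suc (p₁ * q) + a) + q₁ * (suc (p * q₂) + c)
        ≡⟨ collect p q p₁ q₁ q₂ a c ⟩
      X + (q₁ * suc c + q₂ * suc a) ∎
      where
      expand-q : ∀ p q p₁ q₁ q₂ → p * q₁ * q₂ + p₁ * q * q₂ + q ≡ q₂ * (p * q₁) + q * (p₁ * q₂ + 1)
      expand-q = solve-∀
      swap : ∀ p q p₂ q₁ q₂ → q₂ * (p * q₁) + q * (p₂ * q₁) ≡ q₂ * (p * q₁) + q₁ * (p₂ * q)
      swap = solve-∀
      collect : ∀ p q p₁ q₁ q₂ a c → q₂ * (suc (p₁ * q) + a) + q₁ * (suc (p * q₂) + c) ≡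
                p * q₁ * q₂ + p₁ * q * q₂ + (q₁ * suc c + q₂ * suc a)
      collect = solve-∀

  Bracket⇒0<q₁ : ∀ {p₁ q₁ p₂ q₂ p q} → Bracket p₁ q₁ p₂ q₂ p q → 0 < q₁
  Bracket⇒0<q₁ {p₁} {zero} {p = p} {q} b = contradiction (subst (p₁ * q <_) (*-zeroʳ p) (lower b)) n≮0
  Bracket⇒0<q₁ {q₁ = suc _}            b = z<s

  Bracket⇒mediant-≡ : ∀ {p₁ q₁ p₂ q₂ p q} → Bracket p₁ q₁ p₂ q₂ p q → Coprime p q →
                      p * (q₁ + q₂) ≡ (p₁ + p₂) * q → p₁ + p₂ ≡ p × q₁ + q₂ ≡ q
  Bracket⇒mediant-≡ {p₁} {q₁} {p₂} {q₂} {p} {q} b p⊥q p/q≡mediant =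
    sym (*-cancelʳ-≡ p (p₁ + p₂) q {{q≢0}} (trans (cong (p *_) (sym q₁+q₂≡q)) p/q≡mediant)) , q₁+q₂≡q
    where
    0<q₁+q₂ : 0 < q₁ + q₂
    0<q₁+q₂ = <-≤-trans (Bracket⇒0<q₁ b) (m≤m+n q₁ q₂)
    q∣q₁+q₂ : q ∣ q₁ + q₂
    q∣q₁+q₂ = coprime-divisor (Coprime.sym p⊥q) (divides (p₁ + p₂) p/q≡mediant)
    q₁+q₂≡q : q₁ + q₂ ≡ q
    q₁+q₂≡q = ≤-antisym (Bracket⇒mediant-denominator-≤ b) (∣⇒≤ {{>-nonZero 0<q₁+q₂}} q∣q₁+q₂)
    q≢0 : NonZero q
    q≢0 = >-nonZero (subst (0 <_) q₁+q₂≡q 0<q₁+q₂)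

  Bracket-left : ∀ {p₁ q₁ p₂ q₂ p q} → Bracket p₁ q₁ p₂ q₂ p q →
                 p * (q₁ + q₂) < (p₁ + p₂) * q → Bracket p₁ q₁ (p₁ + p₂) (q₁ + q₂) p q
  Bracket-left {p₁} {q₁} {p₂} {q₂} b p/q<mediant = record
    { adjacent = begin
        (p₁ + p₂) * q₁           ≡⟨ *-distribʳ-+ q₁ p₁ p₂ ⟩
        p₁ * q₁ + p₂ * q₁        ≡⟨ cong (p₁ * q₁ +_) (adjacent b) ⟩
        p₁ * q₁ + (p₁ * q₂ + 1)  ≡⟨ regroup p₁ q₁ q₂ ⟩
        p₁ * (q₁ + q₂) + 1       ∎
    ; lower = lower b
    ; upper = p/q<mediant
    }
    where
    open ≡-Reasoning
    regroup : ∀ p₁ q₁ q₂ → p₁ * q₁ + (p₁ * q₂ + 1) ≡ p₁ * (q₁ + q₂) + 1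
    regroup = solve-∀

  Bracket-right : ∀ {p₁ q₁ p₂ q₂ p q} → Bracket p₁ q₁ p₂ q₂ p q →
                  (p₁ + p₂) * q < p * (q₁ + q₂) → Bracket (p₁ + p₂) (q₁ + q₂) p₂ q₂ p q
  Bracket-right {p₁} {q₁} {p₂} {q₂} b mediant<p/q = record
    { adjacent = begin
        p₂ * (q₁ + q₂)         ≡⟨ *-distribˡ-+ p₂ q₁ q₂ ⟩
        p₂ * q₁ + p₂ * q₂      ≡⟨ cong (_+ p₂ * q₂) (adjacent b) ⟩
        p₁ * q₂ + 1 + p₂ * q₂  ≡⟨ regroup p₁ p₂ q₂ ⟩
        (p₁ + p₂) * q₂ + 1     ∎
    ; lower = mediant<p/q
    ; upper = upper b
    }
    where
    open ≡-Reasoning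
    regroup : ∀ p₁ p₂ q₂ → p₁ * q₂ + 1 + p₂ * q₂ ≡ (p₁ + p₂) * q₂ + 1
    regroup = solve-∀

  fuel-step : ∀ {q} m n f → 0 < n → q < m + suc f → q < m + n + f
  fuel-step {q} m n f 0<n q<m+1+f = begin-strict
    q            <⟨ q<m+1+f ⟩
    m + suc f    ≡⟨ +-suc m f ⟩
    suc (m + f)  ≤⟨ +-monoˡ-≤ (m + f) 0<n ⟩
    n + (m + f)  ≡⟨ regroup m n f ⟩
    m + n + f    ∎
    where
    open ≤-Reasoning
    regroup : ∀ m n f → n + (m + f) ≡ m + n + f
    regroup = solve-∀

  -- F(x) = x/(1+x) sends p₁/q₁, p₂/q₂ and p/q to p₁/(p₁+q₁), p₂/(p₂+q₂) and p/(p+q); comparing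
  -- the images of p/q and of the mediant adds p * (p₁ + p₂) to both sides.
  module _ (p q p₁ q₁ p₂ q₂ : ℕ) where

    private
      left≡ : p * ((p₁ + q₁) + (p₂ + q₂)) ≡ p * (p₁ + p₂) + p * (q₁ + q₂)
      left≡ = trans (cong (p *_) (interchange p₁ q₁ p₂ q₂)) (*-distribˡ-+ p (p₁ + p₂) (q₁ + q₂))
      right≡ : (p₁ + p₂) * (p + q) ≡ p * (p₁ + p₂) + (p₁ + p₂) * q
      right≡ = trans (*-distribˡ-+ (p₁ + p₂) p q) (cong (_+ (p₁ + p₂) * q) (*-comm (p₁ + p₂) p))

    F-preserves-≡ : p * (q₁ + q₂) ≡ (p₁ + p₂) * q → p * ((p₁ + q₁) + (p₂ + q₂)) ≡ (p₁ + p₂) * (p + q)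
    F-preserves-≡ eq = trans left≡ (trans (cong (p * (p₁ + p₂) +_) eq) (sym right≡))

    F-preserves-< : p * (q₁ + q₂) < (p₁ + p₂) * q → p * ((p₁ + q₁) + (p₂ + q₂)) < (p₁ + p₂) * (p + q)
    F-preserves-< lt = subst₂ _<_ (sym left≡) (sym right≡) (+-monoʳ-< (p * (p₁ + p₂)) lt)

    F-preserves-> : (p₁ + p₂) * q < p * (q₁ + q₂) → (p₁ + p₂) * (p + q) < p * ((p₁ + q₁) + (p₂ + q₂))
    F-preserves-> gt = subst₂ _<_ (sym right≡) (sym left≡) (+-monoʳ-< (p * (p₁ + p₂)) gt)

  -- Following G_x and G_{F(x)} together

  G½ : Graph
  G½ = G₀ ⊕ G₀

  G₀-spans : Spans G₀ 1
  G₀-spans = spans refl λ { (suc (suc i)) _ → refl ; 0 () ; 1 (s≤s ()) }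

  G½-spans : Spans G½ 2
  G½-spans = spans-⊕ G₀-spans G₀-spans

  -- G = G_x spans q and H = G_{F(x)} spans Q: from degree 5 on, the interior degree counts move up
  -- by one; the first node keeps its degree and the last one gains an edge.
  record InteriorShift (G : Graph) (q : ℕ) (H : Graph) (Q : ℕ) : Set where
    field
      spans-G  : Spans G q
      spans-H  : Spans H Q
      interior : ∀ j → interiorCount (6 + j) H Q ≡ interiorCount (5 + j) G q

  record DegreeShift (G : Graph) (q : ℕ) (H : Graph) (Q : ℕ) : Set where
    field
      interiorShift : InteriorShift G q H Q
      first-≡       : deg H 0 ≡ deg G 0
      last-suc      : deg H Q ≡ suc (deg G q)

  -- The leaves 0/1 (fixed by F) and 1/1 (sent to 1/2) are not in DegreeShift with their images, so
  -- an end of a pair of adjacent fractions is either such a leaf or an inner fraction.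
  data LeftEnd : Graph → ℕ → Graph → ℕ → Set where
    0/1   : LeftEnd G₀ 1 G₀ 1
    inner : ∀ {G q H Q} → DegreeShift G q H Q → LeftEnd G q H Q

  data RightEnd : Graph → ℕ → Graph → ℕ → Set where
    1/1   : RightEnd G₀ 1 G½ 2
    inner : ∀ {G q H Q} → DegreeShift G q H Q → RightEnd G q H Q

  open InteriorShift
  open DegreeShift

  leftShift : ∀ {G q H Q} → LeftEnd G q H Q → InteriorShift G q H Q
  leftShift 0/1       = record { spans-G = G₀-spans ; spans-H = G₀-spans ; interior = λ _ → refl }
  leftShift (inner d) = interiorShift d

  left-first : ∀ {G q H Q} → LeftEnd G q H Q → deg H 0 ≡ deg G 0
  left-first 0/1       = refl
  left-first (inner d) = first-≡ d

  rightShift : ∀ {G q H Q} → RightEnd G q H Q → InteriorShift G q H Q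
  rightShift 1/1       = record { spans-G = G₀-spans ; spans-H = G½-spans ; interior = λ _ → refl }
  rightShift (inner d) = interiorShift d

  right-last : ∀ {G q H Q} → RightEnd G q H Q → deg H Q ≡ suc (deg G q)
  right-last 1/1       = refl
  right-last (inner d) = last-suc d

  -- Two adjacent fractions of the Farey tree together with their images under F.
  record Adjacent (G₁ : Graph) (q₁ : ℕ) (H₁ : Graph) (Q₁ : ℕ)
                  (G₂ : Graph) (q₂ : ℕ) (H₂ : Graph) (Q₂ : ℕ) : Set where
    field
      left     : LeftEnd G₁ q₁ H₁ Q₁
      right    : RightEnd G₂ q₂ H₂ Q₂
      junction : ∀ j → δ (deg H₁ Q₁ + deg H₂ 0) (6 + j) ≡ δ (deg G₁ q₁ + deg G₂ 0) (5 + j)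
  open Adjacent

  module _ {G₁ q₁ H₁ Q₁ G₂ q₂ H₂ Q₂} (adj : Adjacent G₁ q₁ H₁ Q₁ G₂ q₂ H₂ Q₂) where

    private
      L : InteriorShift G₁ q₁ H₁ Q₁
      L = leftShift (left adj)
      R : InteriorShift G₂ q₂ H₂ Q₂
      R = rightShift (right adj)

    mediant-shift : DegreeShift (G₁ ⊕ G₂) (q₁ + q₂) (H₁ ⊕ H₂) (Q₁ + Q₂)
    mediant-shift = record
      { interiorShift = record
        { spans-G  = spans-⊕ (spans-G L) (spans-G R)
        ; spans-H  = spans-⊕ (spans-H L) (spans-H R)
        ; interior = λ j → begin
            interiorCount (6 + j) (H₁ ⊕ H₂) (Q₁ + Q₂)
              ≡⟨ interiorCount-⊕ (spans-H L) (spans-H R) (6 + j) ⟩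
            interiorCount (6 + j) H₁ Q₁ + (δ (deg H₁ Q₁ + deg H₂ 0) (6 + j) + interiorCount (6 + j) H₂ Q₂)
              ≡⟨ cong₂ _+_ (interior L j) (cong₂ _+_ (junction adj j) (interior R j)) ⟩
            interiorCount (5 + j) G₁ q₁ + (δ (deg G₁ q₁ + deg G₂ 0) (5 + j) + interiorCount (5 + j) G₂ q₂)
              ≡⟨ interiorCount-⊕ (spans-G L) (spans-G R) (5 + j) ⟨
            interiorCount (5 + j) (G₁ ⊕ G₂) (q₁ + q₂) ∎
        }
      ; first-≡ = begin
          deg (H₁ ⊕ H₂) 0  ≡⟨ deg-⊕-first (spans-H L) (spans-H R) ⟩
          suc (deg H₁ 0)   ≡⟨ cong suc (left-first (left adj)) ⟩
          suc (deg G₁ 0)   ≡⟨ deg-⊕-first (spans-G L) (spans-G R) ⟨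
          deg (G₁ ⊕ G₂) 0  ∎
      ; last-suc = begin
          deg (H₁ ⊕ H₂) (Q₁ + Q₂)        ≡⟨ deg-⊕-last (spans-H L) (spans-H R) ⟩
          suc (deg H₂ Q₂)                ≡⟨ cong suc (right-last (right adj)) ⟩
          suc (suc (deg G₂ q₂))          ≡⟨ cong suc (deg-⊕-last (spans-G L) (spans-G R)) ⟨
          suc (deg (G₁ ⊕ G₂) (q₁ + q₂))  ∎
      }
      where open ≡-Reasoning

  -- Where an end meets a shifted neighbour, either the junction degree is shifted too or, next to
  -- 0/1 and 1/1, both junction degrees are at most 5 and not counted.
  left-junction : ∀ {G₁ q₁ H₁ Q₁ G H} → LeftEnd G₁ q₁ H₁ Q₁ →
    deg H 0 ≡ deg G 0 → deg G 0 ≡ suc (deg G₁ 0) →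
    ∀ j → δ (deg H₁ Q₁ + deg H 0) (6 + j) ≡ δ (deg G₁ q₁ + deg G 0) (5 + j)
  left-junction 0/1       H₀≡G₀ G₀≡ j rewrite H₀≡G₀ | G₀≡ = refl
  left-junction (inner d) H₀≡G₀ _   j rewrite H₀≡G₀ | last-suc d = refl

  right-junction : ∀ {G₂ q₂ H₂ Q₂ G q H Q} → RightEnd G₂ q₂ H₂ Q₂ →
    deg H Q ≡ suc (deg G q) → deg G q ≡ suc (deg G₂ q₂) →
    ∀ j → δ (deg H Q + deg H₂ 0) (6 + j) ≡ δ (deg G q + deg G₂ 0) (5 + j)
  right-junction 1/1       HQ≡ Gq≡ j rewrite HQ≡ | Gq≡ = refl
  right-junction (inner d) HQ≡ _   j rewrite HQ≡ | first-≡ d = refl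

  adjacent-root : Adjacent G₀ 1 G₀ 1 G₀ 1 G½ 2
  adjacent-root = record { left = 0/1 ; right = 1/1 ; junction = λ _ → refl }

  module _ {G₁ q₁ H₁ Q₁ G₂ q₂ H₂ Q₂} (adj : Adjacent G₁ q₁ H₁ Q₁ G₂ q₂ H₂ Q₂) where

    private
      L : InteriorShift G₁ q₁ H₁ Q₁
      L = leftShift (left adj)
      R : InteriorShift G₂ q₂ H₂ Q₂
      R = rightShift (right adj)
      M : DegreeShift (G₁ ⊕ G₂) (q₁ + q₂) (H₁ ⊕ H₂) (Q₁ + Q₂)
      M = mediant-shift adj

    adjacent-left : Adjacent G₁ q₁ H₁ Q₁ (G₁ ⊕ G₂) (q₁ + q₂) (H₁ ⊕ H₂) (Q₁ + Q₂)
    adjacent-left = record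
      { left     = left adj
      ; right    = inner M
      ; junction = left-junction {G = G₁ ⊕ G₂} {H₁ ⊕ H₂} (left adj) (first-≡ M)
                     (deg-⊕-first (spans-G L) (spans-G R))
      }

    adjacent-right : Adjacent (G₁ ⊕ G₂) (q₁ + q₂) (H₁ ⊕ H₂) (Q₁ + Q₂) G₂ q₂ H₂ Q₂
    adjacent-right = record
      { left     = inner M
      ; right    = right adj
      ; junction = right-junction {G = G₁ ⊕ G₂} {q₁ + q₂} {H₁ ⊕ H₂} {Q₁ + Q₂} (right adj) (last-suc M)
                     (deg-⊕-last (spans-G L) (spans-G R))
      }

  module _ (f p₁ q₁ : ℕ) (G₁ : Graph) (p₂ q₂ : ℕ) (G₂ : Graph) (p q : ℕ) where

    harosDescend-mediant : p * (q₁ + q₂) ≡ (p₁ + p₂) * q →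
      harosDescend (suc f) p₁ q₁ G₁ p₂ q₂ G₂ p q ≡ G₁ ⊕ G₂
    harosDescend-mediant eq rewrite ≡⇒≡ᵇ≡true eq = refl

    harosDescend-left : p * (q₁ + q₂) < (p₁ + p₂) * q →
      harosDescend (suc f) p₁ q₁ G₁ p₂ q₂ G₂ p q ≡ harosDescend f p₁ q₁ G₁ (p₁ + p₂) (q₁ + q₂) (G₁ ⊕ G₂) p q
    harosDescend-left lt rewrite ≢⇒≡ᵇ≡false (<⇒≢ lt) | <⇒<ᵇ≡true lt = refl

    harosDescend-right : (p₁ + p₂) * q < p * (q₁ + q₂) →
      harosDescend (suc f) p₁ q₁ G₁ p₂ q₂ G₂ p q ≡ harosDescend f (p₁ + p₂) (q₁ + q₂) (G₁ ⊕ G₂) p₂ q₂ G₂ p q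
    harosDescend-right gt rewrite ≢⇒≡ᵇ≡false (>⇒≢ gt) | ≥⇒<ᵇ≡false (<⇒≤ gt) = refl

  ≡-DegreeShift : ∀ {G G′ q H H′ Q} → G ≡ G′ → H ≡ H′ → DegreeShift G′ q H′ Q → DegreeShift G q H Q
  ≡-DegreeShift refl refl d = d

  -- The descents towards p/q and towards F(p/q) = p/(p+q) take the same turns.  The invariant
  -- q < q₁ + q₂ + f rules out running out of fuel, since q₁ + q₂ ≤ q.  The denominators Q₁, Q₂ on
  -- the F side are only equal to p₁ + q₁, p₂ + q₂: the descent forms (p₁ + q₁) + (p₂ + q₂).
  harosDescend-shift : ∀ f f′ {p₁ q₁ p₂ q₂ p q G₁ H₁ G₂ H₂ Q₁ Q₂} →
    Q₁ ≡ p₁ + q₁ → Q₂ ≡ p₂ + q₂ → Adjacent G₁ q₁ H₁ Q₁ G₂ q₂ H₂ Q₂ →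
    Bracket p₁ q₁ p₂ q₂ p q → Coprime p q → q < q₁ + q₂ + f → f ≤ f′ →
    DegreeShift (harosDescend f p₁ q₁ G₁ p₂ q₂ G₂ p q) q
                (harosDescend f′ p₁ Q₁ H₁ p₂ Q₂ H₂ p (p + q)) (p + q)
  harosDescend-shift zero f′ {q = q} _ _ _ b _ q<q₁+q₂ _ =
    contradiction (Bracket⇒mediant-denominator-≤ b) (<⇒≱ (subst (q <_) (+-identityʳ _) q<q₁+q₂))
  harosDescend-shift (suc f) (suc f′) {p₁} {q₁} {p₂} {q₂} {p} {q} {G₁} {H₁} {G₂} {H₂}
                     refl refl adj b p⊥q fuel (s≤s f≤f′)
    with <-cmp (p * (q₁ + q₂)) ((p₁ + p₂) * q)
  ... | tri≈ _ hit _ =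
    let p₁+p₂≡p , q₁+q₂≡q = Bracket⇒mediant-≡ b p⊥q hit in
    ≡-DegreeShift (harosDescend-mediant f p₁ q₁ G₁ p₂ q₂ G₂ p q hit)
      (harosDescend-mediant f′ p₁ (p₁ + q₁) H₁ p₂ (p₂ + q₂) H₂ p (p + q)
        (F-preserves-≡ p q p₁ q₁ p₂ q₂ hit))
      (subst₂ (λ q′ Q′ → DegreeShift (G₁ ⊕ G₂) q′ (H₁ ⊕ H₂) Q′) q₁+q₂≡q
        (trans (interchange p₁ q₁ p₂ q₂) (cong₂ _+_ p₁+p₂≡p q₁+q₂≡q)) (mediant-shift adj))
  ... | tri< lt _ _ =
    ≡-DegreeShift (harosDescend-left f p₁ q₁ G₁ p₂ q₂ G₂ p q lt)
      (harosDescend-left f′ p₁ (p₁ + q₁) H₁ p₂ (p₂ + q₂) H₂ p (p + q)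
        (F-preserves-< p q p₁ q₁ p₂ q₂ lt))
      (harosDescend-shift f f′ refl (interchange p₁ q₁ p₂ q₂) (adjacent-left adj) (Bracket-left b lt) p⊥q
        (subst (q <_) (cong (_+ f) (+-comm (q₁ + q₂) q₁)) (fuel-step (q₁ + q₂) q₁ f (Bracket⇒0<q₁ b) fuel))
        f≤f′)
  ... | tri> _ _ gt =
    ≡-DegreeShift (harosDescend-right f p₁ q₁ G₁ p₂ q₂ G₂ p q gt)
      (harosDescend-right f′ p₁ (p₁ + q₁) H₁ p₂ (p₂ + q₂) H₂ p (p + q)
        (F-preserves-> p q p₁ q₁ p₂ q₂ gt))
      (harosDescend-shift f f′ (interchange p₁ q₁ p₂ q₂) refl (adjacent-right adj) (Bracket-right b gt) p⊥q
        (fuel-step (q₁ + q₂) q₂ f (spans⇒0< (spans-G (rightShift (right adj)))) fuel) f≤f′)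

  DegreeShift⇒countDeg : ∀ {G q H Q} → DegreeShift G q H Q → ∀ j →
    δ (boundaryDeg H Q) (6 + j) + interiorCount (6 + j) H Q ≡
    δ (boundaryDeg G q) (5 + j) + interiorCount (5 + j) G q
  DegreeShift⇒countDeg {G} {q} {H} {Q} d j =
    cong₂ _+_ (cong (λ b → δ b (6 + j)) boundary-suc) (interior (interiorShift d) j)
    where
    boundary-suc : boundaryDeg H Q ≡ suc (boundaryDeg G q)
    boundary-suc = trans (cong₂ _+_ (first-≡ d) (last-suc d)) (+-suc (deg G 0) (deg G q))

  haros≡harosDescend : ∀ {p q} → 0 < p → p < q → haros p q ≡ harosDescend q 0 1 G₀ 1 1 G₀ p q
  haros≡harosDescend {suc _} _ p<q rewrite ≢⇒≡ᵇ≡false (<⇒≢ p<q) = refl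

  <⇒F<½ : ∀ {p q} → p < q → p * 2 < 1 * (p + q)
  <⇒F<½ {p} {q} p<q = subst₂ _<_ (sym (trans (*-comm p 2) (cong (p +_) (+-identityʳ p))))
                                  (sym (*-identityˡ (p + q))) (+-monoʳ-< p p<q)

  -- The first turn towards p/(p+q) < 1/2 is to the left, to the pair 0/1, 1/2.
  haros-F≡harosDescend : ∀ {p q} → 0 < p → p < q →
    haros p (p + q) ≡ harosDescend (p ∸ 1 + q) 0 1 G₀ 1 2 G½ p (p + q)
  haros-F≡harosDescend {suc p′} {q} 0<p p<q =
    trans (haros≡harosDescend 0<p (m<m+n (suc p′) (<-trans 0<p p<q)))
          (harosDescend-left (p′ + q) 0 1 G₀ 1 1 G₀ (suc p′) (suc p′ + q) (<⇒F<½ p<q))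

  Bracket-root : ∀ {p q} → 0 < p → p < q → Bracket 0 1 1 1 p q
  Bracket-root {p} {q} 0<p p<q = record
    { adjacent = refl
    ; lower    = subst (0 <_) (sym (*-identityʳ p)) 0<p
    ; upper    = subst₂ _<_ (sym (*-identityʳ p)) (sym (*-identityˡ q)) p<q
    }

  haros-F-shift : ∀ {p q} → Coprime p q → 0 < p → p < q →
    DegreeShift (haros p q) q (haros p (p + q)) (p + q)
  haros-F-shift {suc p′} {q} p⊥q 0<p p<q =
    ≡-DegreeShift (haros≡harosDescend 0<p p<q) (haros-F≡harosDescend 0<p p<q)
      (harosDescend-shift q (p′ + q) refl refl adjacent-root (Bracket-root 0<p p<q) p⊥q (m<n+m q z<s)
        (m≤n+m q p′))

  countDeg-F-5+ : ∀ {p q} → Coprime p q → p ≤ q → ∀ j →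
    countDeg (6 + j) p (p + q) ≡ countDeg (5 + j) p q
  countDeg-F-5+ {zero} p⊥q _ j with refl ← 0-coprimeTo-m⇒m≡1 p⊥q = refl
  countDeg-F-5+ {suc p′} {q} p⊥q p≤q j with m≤n⇒m<n∨m≡n p≤q
  ... | inj₂ refl with refl ← p⊥q (∣-refl , ∣-refl) = refl
  ... | inj₁ p<q = begin
    countDeg (6 + j) p (p + q)
      ≡⟨ countDeg-split (6 + j) p (p + q) ⟩
    δ (boundaryDeg (haros p (p + q)) (p + q)) (6 + j) + interiorCount (6 + j) (haros p (p + q)) (p + q)
      ≡⟨ DegreeShift⇒countDeg (haros-F-shift p⊥q z<s p<q) j ⟩
    δ (boundaryDeg (haros p q) q) (5 + j) + interiorCount (5 + j) (haros p q) q
      ≡⟨ countDeg-split (5 + j) p q ⟨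
    countDeg (5 + j) p q ∎
    where
    open ≡-Reasoning
    p : ℕ
    p = suc p′

  countDeg-F : ∀ {p q} → Coprime p q → p ≤ q → ∀ k → 5 ≤ k →
    countDeg (suc k) p (p + q) ≡ countDeg k p q
  countDeg-F p⊥q p≤q _ (s≤s (s≤s (s≤s (s≤s (s≤s {n = j} z≤n))))) = countDeg-F-5+ p⊥q p≤q j

open HarosDegrees using (countDeg-F)

open import Data.Integer as ℤ using (+_; -[1+_])
import Data.Integer.Properties as ℤ
open import Data.Nat as ℕ using ()
open import Data.Nat.Coprimality as Coprime using (Coprime)
open import Data.Nat.Properties using (+-suc)
open import Data.Nat.Tactic.RingSolver using (solve-∀)
open import Data.Rational as ℚ using (ℚ; mkℚ; 0ℚ; 1ℚ; _≤_; *≤*; _/_; _*_; toℚᵘ; nonNegative)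
open import Data.Rational.Properties
open import Data.Rational.Unnormalised as ℚᵘ using (mkℚᵘ; *≡*) renaming (_≃_ to _≃ᵘ_)
import Data.Rational.Unnormalised.Properties as ℚᵘ

+-mkℚᵘ : ∀ a b c e →
         mkℚᵘ (+ a) b ℚᵘ.+ mkℚᵘ (+ c) e ≡ mkℚᵘ (+ (a ℕ.* suc e + c ℕ.* suc b)) (e + b ℕ.* suc e)
+-mkℚᵘ a b c e = cong (λ n → mkℚᵘ n (e + b ℕ.* suc e))
  (sym (trans (ℤ.pos-+ (a ℕ.* suc e) (c ℕ.* suc b))
              (cong₂ ℤ._+_ (ℤ.pos-* a (suc e)) (ℤ.pos-* c (suc b)))))

*-mkℚᵘ : ∀ a b c e → mkℚᵘ (+ a) b ℚᵘ.* mkℚᵘ (+ c) e ≡ mkℚᵘ (+ (a ℕ.* c)) (e + b ℕ.* suc e)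
*-mkℚᵘ a b c e = cong (λ n → mkℚᵘ n (e + b ℕ.* suc e)) (sym (ℤ.pos-* a c))

mkℚᵘ-≃ : ∀ {a b c e} → a ℕ.* suc e ≡ c ℕ.* suc b → mkℚᵘ (+ a) b ≃ᵘ mkℚᵘ (+ c) e
mkℚᵘ-≃ {a} {b} {c} {e} eq =
  *≡* (trans (sym (ℤ.pos-* a (suc e))) (trans (cong +_ eq) (ℤ.pos-* c (suc b))))

/[p+q]*[1+p/q]≡/q : ∀ n p d .(c : Coprime p (suc d)) →
                    (+ n) / suc (p + d) * (1ℚ ℚ.+ mkℚ (+ p) d c) ≡ (+ n) / suc d
/[p+q]*[1+p/q]≡/q n p d c = toℚᵘ-injective (begin
  toℚᵘ ((+ n) / suc (p + d) * (1ℚ ℚ.+ mkℚ (+ p) d c))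
    ≈⟨ toℚᵘ-homo-* ((+ n) / suc (p + d)) _ ⟩
  toℚᵘ ((+ n) / suc (p + d)) ℚᵘ.* toℚᵘ (1ℚ ℚ.+ mkℚ (+ p) d c)
    ≈⟨ ℚᵘ.*-cong (toℚᵘ-fromℚᵘ (mkℚᵘ (+ n) (p + d))) (toℚᵘ-homo-+ 1ℚ (mkℚ (+ p) d c)) ⟩
  mkℚᵘ (+ n) (p + d) ℚᵘ.* (mkℚᵘ (+ 1) 0 ℚᵘ.+ mkℚᵘ (+ p) d)
    ≡⟨ trans (cong (mkℚᵘ (+ n) (p + d) ℚᵘ.*_) (+-mkℚᵘ 1 0 p d)) (*-mkℚᵘ n (p + d) _ _) ⟩
  mkℚᵘ (+ (n ℕ.* (1 ℕ.* suc d + p ℕ.* 1))) (d + 0 ℕ.* suc d + (p + d) ℕ.* suc (d + 0 ℕ.* suc d))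
    ≈⟨ mkℚᵘ-≃ (cross n p d) ⟩
  mkℚᵘ (+ n) d
    ≈⟨ toℚᵘ-fromℚᵘ (mkℚᵘ (+ n) d) ⟨
  toℚᵘ ((+ n) / suc d) ∎)
  where
  open ℚᵘ.≃-Reasoning
  cross : ∀ n p d → n ℕ.* (1 ℕ.* suc d + p ℕ.* 1) ℕ.* suc d ≡
          n ℕ.* suc (d + 0 ℕ.* suc d + (p + d) ℕ.* suc (d + 0 ℕ.* suc d))
  cross = solve-∀

module _ (x : ℚ) (h : 0ℚ ≤ x) where

  *[1+x]≡⇒≡*1/[1+x] : ∀ {a b} → a * (1ℚ ℚ.+ x) ≡ b → a ≡ b * 1/[1+ x ] h
  *[1+x]≡⇒≡*1/[1+x] {a} {b} a[1+x]≡b = begin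
    a                               ≡⟨ *-identityʳ a ⟨
    a * 1ℚ                          ≡⟨ cong (a *_) (*-inverseʳ (1ℚ ℚ.+ x) {{1+x≢0}}) ⟨
    a * ((1ℚ ℚ.+ x) * 1/[1+ x ] h)  ≡⟨ *-assoc a (1ℚ ℚ.+ x) _ ⟨
    a * (1ℚ ℚ.+ x) * 1/[1+ x ] h    ≡⟨ cong (_* 1/[1+ x ] h) a[1+x]≡b ⟩
    b * 1/[1+ x ] h                 ∎
    where
    open ≡-Reasoning
    1+x≢0 : ℚ.NonZero (1ℚ ℚ.+ x)
    1+x≢0 = pos⇒nonZero (1ℚ ℚ.+ x) {{pos+nonNeg⇒pos 1ℚ x {{nonNegative h}}}}

theorem11 : (x : ℚ) → (h : 0ℚ ≤ x) → x ≤ 1ℚ →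
    (k : ℕ) → 5 Data.Nat.≤ k →
    P (suc k) (F x h) ≡ 1/[1+ x ] h * P k x
theorem11 (mkℚ -[1+ _ ] _ _) (*≤* ()) _ _ _
theorem11 x@(mkℚ (+ p) d c) h (*≤* x≤1) k 5≤k = begin
  -- implicit arguments are supplied (here and in scale): inferring them would normalise F x h
  P (suc k) (F x h)                                   ≡⟨ cong (P (suc k)) {F x h} {y} F[x]≡ ⟩
  (+ countDeg (suc k) p (suc (p + d))) / suc (p + d)  ≡⟨ cong (λ n → (+ n) / suc (p + d)) counts ⟩
  (+ countDeg k p (suc d)) / suc (p + d)              ≡⟨ scale ⟩
  1/[1+ x ] h * P k x                                 ∎
  where
  open ≡-Reasoning
  p⊥q : Coprime p (suc d)
  p⊥q = Coprime.recompute c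
  p⊥p+q : Coprime p (suc (p + d))
  p⊥p+q = subst (Coprime p) (+-suc p d) (Coprime.sym (Coprime.coprime-+ (Coprime.sym p⊥q)))
  y : ℚ
  y = mkℚ (+ p) (p + d) p⊥p+q
  p≤q : p ℕ.≤ suc d
  p≤q = ℤ.drop‿+≤+ (subst₂ ℤ._≤_ (ℤ.*-identityʳ (+ p)) (ℤ.*-identityˡ (+ suc d)) x≤1)
  counts : countDeg (suc k) p (suc (p + d)) ≡ countDeg k p (suc d)
  counts = trans (cong (countDeg (suc k) p) (sym (+-suc p d))) (countDeg-F p⊥q p≤q k 5≤k)
  scale : (+ countDeg k p (suc d)) / suc (p + d) ≡ 1/[1+ x ] h * P k x
  scale = trans (*[1+x]≡⇒≡*1/[1+x] x h {b = P k x} (/[p+q]*[1+p/q]≡/q (countDeg k p (suc d)) p d c))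
                (*-comm (P k x) (1/[1+ x ] h))
  F[x]≡ : F x h ≡ y
  F[x]≡ = trans (sym (*[1+x]≡⇒≡*1/[1+x] x h (trans (/[p+q]*[1+p/q]≡/q p p d c) (normalize-coprime c))))
                (normalize-coprime p⊥p+q)
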